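{- Let $P\subseteq S_n$ be a permutation array with Hamming distance $d$, and let $Q\subseteq S_{n-2}$ be the array obtained from $P$ by applying the contraction operation two times, i.e. $Q=\{(\sigma^{CT})^{CT}\mid \sigma\in P\}$. Then: (a) the Hamming distance of $Q$ is at least $d-6$; (b) if, for any distinct $\sigma,\tau\in P$, the cycle decomposition of $\sigma^{ -1}\tau$ contains no 3-cycle and no 5-cycle, then the Hamming distance of $Q$ is at least $d-4$.
   Context: $S_m$ is the symmetric group on $Z_m=\{0,\dots,m-1\}$, with composition $(\pi\sigma)(i)=\sigma(\pi(i))$. For $\sigma\in S_m$, its contraction $\sigma^{CT}\in S_{m-1}$ is defined for $0\le x\le m-2$ by $\sigma^{CT}(x)=\sigma(x)$ if $\sigma(x)\ne m-1$, and $\sigma^{CT}(x)=\sigma(m-1)$ if $\sigma(x)=m-1$. $hd(\pi,\sigma)$ is the number of points where $\pi,\sigma$ differ; the Hamming distance of an array is the minimum of $hd$ over pairs of distinct elements. -}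

module Defs where

open import Data.Nat.Base using (ℕ; zero; suc; _≤_; _∸_)
open import Data.Fin.Base using (Fin; fromℕ; inject₁; lower₁; toℕ)
open import Data.Fin.Properties using (_≟_; toℕ-injective; toℕ-fromℕ;
  inject₁-lower₁; inject₁-injective; fromℕ≢inject₁)
open import Data.Fin.Permutation using (Permutation′; permutation; _⟨$⟩ʳ_; _⟨$⟩ˡ_;
  inverseˡ; inverseʳ)
open import Data.List.Base using (List; length; filter; allFin)
open import Data.Product.Base using (Σ; _×_; _,_; ∃)
open import Data.Sum.Base using (_⊎_; inj₁; inj₂)
open import Relation.Nullary using (¬_; yes; no; ¬?)
open import Relation.Nullary.Negation using (contradiction)
open import Relation.Binary.PropositionalEquality
  using (_≡_; _≢_; refl; sym; trans; cong; subst)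

-- Permutations of Z_n = Fin n.  σ(i) is written  σ ⟨$⟩ʳ i.
-- The element m-1 of Fin m is  fromℕ (m - 1)  ("last").

lowerL : ∀ {m} (i : Fin (suc m)) → i ≢ fromℕ m → Fin m
lowerL {m} i ne = lower₁ i (λ eq → ne (toℕ-injective (trans (sym eq) (sym (toℕ-fromℕ m)))))

-- Contraction on raw functions, following the paper's definition:
--   f^CT(x) = f(x)       if f(x) ≠ m-1,
--   f^CT(x) = f(m-1)     if f(x) = m-1.
-- The last clause (f(x) = f(m-1) = m-1) is impossible for a permutation
-- and only serves to make the function total.
ctFun : ∀ {m} → (Fin (suc m) → Fin (suc m)) → Fin m → Fin m
ctFun {m} f x with f (inject₁ x) ≟ fromℕ m
... | no ne = lowerL (f (inject₁ x)) ne
... | yes _ with f (fromℕ m) ≟ fromℕ m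
...   | no ne = lowerL (f (fromℕ m)) ne
...   | yes _ = x

ctFun-spec : ∀ {m} (f g : Fin (suc m) → Fin (suc m)) →
  (∀ i → g (f i) ≡ i) → (x : Fin m) →
  (f (inject₁ x) ≢ fromℕ m × inject₁ (ctFun f x) ≡ f (inject₁ x)) ⊎
  (f (inject₁ x) ≡ fromℕ m × inject₁ (ctFun f x) ≡ f (fromℕ m))
ctFun-spec {m} f g gf x with f (inject₁ x) ≟ fromℕ m
... | no ne = inj₁ (ne , inject₁-lower₁ _ _)
... | yes e with f (fromℕ m) ≟ fromℕ m
...   | no ne = inj₂ (e , inject₁-lower₁ _ _)
...   | yes e′ = contradiction
        (trans (sym (gf (fromℕ m))) (trans (cong g (trans e′ (sym e))) (gf (inject₁ x))))
        fromℕ≢inject₁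

ctFun-inv : ∀ {m} (f g : Fin (suc m) → Fin (suc m)) →
  (∀ i → g (f i) ≡ i) → (∀ i → f (g i) ≡ i) → (x : Fin m) →
  ctFun g (ctFun f x) ≡ x
ctFun-inv {m} f g gf fg x with ctFun-spec f g gf x
... | inj₁ (ne , eq) with ctFun-spec g f fg (ctFun f x)
...   | inj₁ (_ , eq′) = inject₁-injective (trans eq′ (trans (cong g eq) (gf _)))
...   | inj₂ (e′ , _) = contradiction (trans (sym e′) (trans (cong g eq) (gf _))) fromℕ≢inject₁
ctFun-inv {m} f g gf fg x | inj₂ (e , eq) with ctFun-spec g f fg (ctFun f x)
...   | inj₁ (ne′ , _) = contradiction (trans (cong g eq) (gf _)) ne′
...   | inj₂ (_ , eq′) = inject₁-injective (trans eq′ (trans (cong g (sym e)) (gf _)))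

contract : ∀ {m} → Permutation′ (suc m) → Permutation′ m
contract σ = permutation (ctFun (σ ⟨$⟩ʳ_)) (ctFun (σ ⟨$⟩ˡ_))
  (ctFun-inv (σ ⟨$⟩ˡ_) (σ ⟨$⟩ʳ_) (λ i → inverseʳ σ) (λ i → inverseˡ σ))
  (ctFun-inv (σ ⟨$⟩ʳ_) (σ ⟨$⟩ˡ_) (λ i → inverseˡ σ) (λ i → inverseʳ σ))

contract² : ∀ {m} → Permutation′ (suc (suc m)) → Permutation′ m
contract² σ = contract (contract σ)

_≈ₚ_ : ∀ {n} → Permutation′ n → Permutation′ n → Set
π ≈ₚ σ = ∀ x → π ⟨$⟩ʳ x ≡ σ ⟨$⟩ʳ x

hd : ∀ {n} → Permutation′ n → Permutation′ n → ℕ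
hd {n} π σ = length (filter (λ x → ¬? (π ⟨$⟩ʳ x ≟ σ ⟨$⟩ʳ x)) (allFin n))

PermArray : ℕ → Set₁
PermArray n = Permutation′ n → Set

HDAtLeast : ∀ {n} → PermArray n → ℕ → Set
HDAtLeast A k = ∀ π σ → A π → A σ → ¬ (π ≈ₚ σ) → k ≤ hd π σ

HasHammingDistance : ∀ {n} → PermArray n → ℕ → Set
HasHammingDistance A d =
  HDAtLeast A d × Σ _ λ π → Σ _ λ σ → A π × A σ × ¬ (π ≈ₚ σ) × hd π σ ≡ d

contract²Array : ∀ {m} → PermArray (suc (suc m)) → PermArray m
contract²Array P ρ = Σ _ λ σ → P σ × ρ ≈ₚ contract² σ

-- Cycles.  With the composition convention (πσ)(i) = σ(π(i)),
-- σ⁻¹τ is the map i ↦ τ(σ⁻¹(i)).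

invComp : ∀ {n} → Permutation′ n → Permutation′ n → Fin n → Fin n
invComp σ τ i = τ ⟨$⟩ʳ (σ ⟨$⟩ˡ i)

iter : ∀ {A : Set} → (A → A) → ℕ → A → A
iter f zero    a = a
iter f (suc k) a = f (iter f k a)

OnCycleOfLength : ∀ {n} → (Fin n → Fin n) → ℕ → Fin n → Set
OnCycleOfLength f k x =
  iter f k x ≡ x × (∀ j → 1 ≤ j → suc j ≤ k → iter f j x ≢ x)

HasCycleOfLength : ∀ {n} → (Fin n → Fin n) → ℕ → Set
HasCycleOfLength f k = ∃ λ x → OnCycleOfLength f k x

module Submission where

-- Write f = σ⁻¹τ (i ↦ τ(σ⁻¹(i))), L = m-1, c = σ(L), e = τ(L).  Contracting
-- σ,τ ↦ σ^CT,τ^CT forgets L and redirects the point sent to L, so at most three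
-- disagreements are lost: the one at L (if c ≠ e), the one at σ⁻¹(L) (only if
-- f(L) = c ≠ L) and the one at τ⁻¹(L) (only if f(e) = L ≠ e).  Hence
-- hd(σ,τ) ≤ hd(σ^CT,τ^CT) + 3, and twice this gives (a).  If all three are lost,
-- L ↦ c ↦ e ↦ L is a 3-cycle of f.  For (b): if the second step loses three
-- points, σ^CT⁻¹τ^CT has a 3-cycle; if the first step loses two points, then
-- σ^CT⁻¹τ^CT is f with one short detour spliced out, so that 3-cycle lifts to a
-- 3-cycle or 5-cycle of f.  Either way at most four points are lost.

open import Defs
open import Data.Nat.Base using (ℕ; zero; suc; _+_; _∸_; _≤_; z≤n; s≤s)
open import Data.Nat.Properties using (≤-refl; ≤-trans; ≤-reflexive; +-mono-≤;
  +-monoˡ-≤; +-monoʳ-≤; +-assoc; +-comm; +-identityʳ; m≤n+o⇒m∸n≤o;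
  +-commutativeSemigroup; module ≤-Reasoning)
open import Algebra.Properties.CommutativeSemigroup +-commutativeSemigroup
  using (interchange)
open import Data.Fin.Base using (Fin; zero; suc; inject₁; fromℕ)
open import Data.Fin.Properties using (_≟_; inject₁-injective; fromℕ≢inject₁;
  0≢1+n; suc-injective)
open import Data.Fin.Permutation using (Permutation′; _⟨$⟩ʳ_; _⟨$⟩ˡ_; inverseˡ;
  inverseʳ)
open import Data.List.Base using (length; filter; tabulate)
open import Data.Product.Base using (_×_; _,_; proj₁)
open import Data.Sum.Base using (_⊎_; inj₁; inj₂; [_,_])
open import Data.Empty using (⊥-elim)
open import Function.Base using (id)
open import Relation.Nullary using (¬_; Dec; yes; no; ¬?)
open import Relation.Nullary.Decidable using (_×-dec_)
open import Relation.Binary.PropositionalEquality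
  using (_≡_; _≢_; refl; sym; trans; cong; cong₂; subst₂)

𝟙 : ∀ {A : Set} → Dec A → ℕ
𝟙 (yes _) = 1
𝟙 (no _)  = 0

𝟙≤1 : ∀ {A : Set} (a : Dec A) → 𝟙 a ≤ 1
𝟙≤1 (yes _) = ≤-refl
𝟙≤1 (no _)  = z≤n

𝟙-mono : ∀ {A B : Set} (a : Dec A) (b : Dec B) → (A → B) → 𝟙 a ≤ 𝟙 b
𝟙-mono (yes _) (yes _) _   = ≤-refl
𝟙-mono (yes x) (no ¬y) A→B = ⊥-elim (¬y (A→B x))
𝟙-mono (no _)  _       _   = z≤n

𝟙-∪ : ∀ {A B C : Set} (a : Dec A) (b : Dec B) (c : Dec C) →
  (A → B ⊎ C) → 𝟙 a ≤ 𝟙 b + 𝟙 c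
𝟙-∪ (no _)  _       _       _ = z≤n
𝟙-∪ (yes _) (yes _) _       _ = s≤s z≤n
𝟙-∪ (yes _) (no _)  (yes _) _ = s≤s z≤n
𝟙-∪ (yes x) (no ¬y) (no ¬z) h = ⊥-elim ([ ¬y , ¬z ] (h x))

𝟙-sum≤2 : ∀ {A B C : Set} (a : Dec A) (b : Dec B) (c : Dec C) →
  ¬ (A × B × C) → 𝟙 a + (𝟙 b + 𝟙 c) ≤ 2
𝟙-sum≤2 (yes x) (yes y) (yes z) ¬abc = ⊥-elim (¬abc (x , y , z))
𝟙-sum≤2 (yes _) (yes _) (no _)  _ = ≤-refl
𝟙-sum≤2 (yes _) (no _)  c       _ = s≤s (𝟙≤1 c)
𝟙-sum≤2 (no _)  b       c       _ = +-mono-≤ (𝟙≤1 b) (𝟙≤1 c)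

𝟙-sum≤1 : ∀ {A B C : Set} (a : Dec A) (b : Dec B) (c : Dec C) →
  ¬ (A × B) → ¬ (A × C) → ¬ (B × C) → 𝟙 a + (𝟙 b + 𝟙 c) ≤ 1
𝟙-sum≤1 (yes x) (yes y) _       ¬ab _   _   = ⊥-elim (¬ab (x , y))
𝟙-sum≤1 (yes x) (no _)  (yes z) _   ¬ac _   = ⊥-elim (¬ac (x , z))
𝟙-sum≤1 (yes _) (no _)  (no _)  _   _   _   = ≤-refl
𝟙-sum≤1 (no _)  (yes y) (yes z) _   _   ¬bc = ⊥-elim (¬bc (y , z))
𝟙-sum≤1 (no _)  (yes _) (no _)  _   _   _   = ≤-refl
𝟙-sum≤1 (no _)  (no _)  c       _   _   _   = 𝟙≤1 c

count : ∀ {n} {P : Fin n → Set} → (∀ x → Dec (P x)) → ℕ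
count {zero}  P? = 0
count {suc n} P? = 𝟙 (P? zero) + count (λ x → P? (suc x))

length-filter-tabulate : ∀ {n} {A : Set} {P : A → Set} (P? : ∀ a → Dec (P a))
  (g : Fin n → A) → length (filter P? (tabulate g)) ≡ count (λ x → P? (g x))
length-filter-tabulate {zero}  P? g = refl
length-filter-tabulate {suc n} P? g with P? (g zero)
... | yes _ = cong suc (length-filter-tabulate P? (λ x → g (suc x)))
... | no _  = length-filter-tabulate P? (λ x → g (suc x))

count-last : ∀ {n} {P : Fin (suc n) → Set} (P? : ∀ x → Dec (P x)) →
  count P? ≡ count (λ x → P? (inject₁ x)) + 𝟙 (P? (fromℕ n))
count-last {zero}  P? = +-identityʳ _
count-last {suc n} P? =
  trans (cong (𝟙 (P? zero) +_) (count-last (λ x → P? (suc x))))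
        (sym (+-assoc (𝟙 (P? zero)) _ _))

count-mono : ∀ {n} {P Q : Fin n → Set} (P? : ∀ x → Dec (P x)) (Q? : ∀ x → Dec (Q x)) →
  (∀ x → P x → Q x) → count P? ≤ count Q?
count-mono {zero}  P? Q? P⊆Q = z≤n
count-mono {suc n} P? Q? P⊆Q = +-mono-≤ (𝟙-mono (P? zero) (Q? zero) (P⊆Q zero))
  (count-mono (λ x → P? (suc x)) (λ x → Q? (suc x)) (λ x → P⊆Q (suc x)))

count-∪ : ∀ {n} {P Q R : Fin n → Set} (P? : ∀ x → Dec (P x))
  (Q? : ∀ x → Dec (Q x)) (R? : ∀ x → Dec (R x)) →
  (∀ x → P x → Q x ⊎ R x) → count P? ≤ count Q? + count R?
count-∪ {zero}  P? Q? R? P⊆Q∪R = z≤n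
count-∪ {suc n} P? Q? R? P⊆Q∪R = ≤-trans
  (+-mono-≤ (𝟙-∪ (P? zero) (Q? zero) (R? zero) (P⊆Q∪R zero))
            (count-∪ (λ x → P? (suc x)) (λ x → Q? (suc x)) (λ x → R? (suc x))
                     (λ x → P⊆Q∪R (suc x))))
  (≤-reflexive (interchange (𝟙 (Q? zero)) (𝟙 (R? zero)) _ _))

count-empty : ∀ {n} {P : Fin n → Set} (P? : ∀ x → Dec (P x)) →
  (∀ x → ¬ P x) → count P? ≡ 0
count-empty {zero}  P? ¬P = refl
count-empty {suc n} P? ¬P with P? zero
... | yes p = ⊥-elim (¬P zero p)
... | no _  = count-empty (λ x → P? (suc x)) (λ x → ¬P (suc x))

count-unique : ∀ {n} {P : Fin n → Set} (P? : ∀ x → Dec (P x)) →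
  (∀ x y → P x → P y → x ≡ y) → count P? ≤ 1
count-unique {zero}  P? unique = z≤n
count-unique {suc n} P? unique with P? zero
... | yes p = ≤-reflexive (cong suc (count-empty (λ x → P? (suc x))
                (λ x q → 0≢1+n (unique zero (suc x) p q))))
... | no _  = count-unique (λ x → P? (suc x))
                (λ x y p q → suc-injective (unique (suc x) (suc y) p q))

count≤𝟙 : ∀ {n} {P : Fin n → Set} {Q : Set} (P? : ∀ x → Dec (P x)) (Q? : Dec Q) →
  (∀ x → P x → Q) → (∀ x y → P x → P y → x ≡ y) → count P? ≤ 𝟙 Q?
count≤𝟙 P? (yes _) P⇒Q unique = count-unique P? unique
count≤𝟙 P? (no ¬q) P⇒Q unique = ≤-reflexive (count-empty P? (λ x p → ¬q (P⇒Q x p)))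

disagree? : ∀ {n} (π ρ : Permutation′ n) (x : Fin n) → Dec (π ⟨$⟩ʳ x ≢ ρ ⟨$⟩ʳ x)
disagree? π ρ x = ¬? (π ⟨$⟩ʳ x ≟ ρ ⟨$⟩ʳ x)

hd-count : ∀ {n} (π ρ : Permutation′ n) → hd π ρ ≡ count (disagree? π ρ)
hd-count π ρ = length-filter-tabulate (disagree? π ρ) id

hd-resp-≈ : ∀ {n} {π π′ ρ ρ′ : Permutation′ n} → π ≈ₚ π′ → ρ ≈ₚ ρ′ → hd π ρ ≤ hd π′ ρ′
hd-resp-≈ {π = π} {π′} {ρ} {ρ′} π≈π′ ρ≈ρ′ =
  subst₂ _≤_ (sym (hd-count π ρ)) (sym (hd-count π′ ρ′))
    (count-mono (disagree? π ρ) (disagree? π′ ρ′)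
      (λ x π≢ρ π′≡ρ′ → π≢ρ (trans (π≈π′ x) (trans π′≡ρ′ (sym (ρ≈ρ′ x))))))

contract-spec : ∀ {k} (σ : Permutation′ (suc k)) (x : Fin k) →
  (σ ⟨$⟩ʳ inject₁ x ≢ fromℕ k × inject₁ (contract σ ⟨$⟩ʳ x) ≡ σ ⟨$⟩ʳ inject₁ x) ⊎
  (σ ⟨$⟩ʳ inject₁ x ≡ fromℕ k × inject₁ (contract σ ⟨$⟩ʳ x) ≡ σ ⟨$⟩ʳ fromℕ k)
contract-spec σ = ctFun-spec (σ ⟨$⟩ʳ_) (σ ⟨$⟩ˡ_) (λ _ → inverseˡ σ)

contract-specˡ : ∀ {k} (σ : Permutation′ (suc k)) (x : Fin k) →
  (σ ⟨$⟩ˡ inject₁ x ≢ fromℕ k × inject₁ (contract σ ⟨$⟩ˡ x) ≡ σ ⟨$⟩ˡ inject₁ x) ⊎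
  (σ ⟨$⟩ˡ inject₁ x ≡ fromℕ k × inject₁ (contract σ ⟨$⟩ˡ x) ≡ σ ⟨$⟩ˡ fromℕ k)
contract-specˡ σ = ctFun-spec (σ ⟨$⟩ˡ_) (σ ⟨$⟩ʳ_) (λ _ → inverseʳ σ)

contract-resp-≈ : ∀ {k} {σ τ : Permutation′ (suc k)} → σ ≈ₚ τ → contract σ ≈ₚ contract τ
contract-resp-≈ {σ = σ} {τ} σ≈τ x with contract-spec σ x | contract-spec τ x
... | inj₁ (_ , s) | inj₁ (_ , t) = inject₁-injective (trans s (trans (σ≈τ _) (sym t)))
... | inj₁ (s , _) | inj₂ (t , _) = ⊥-elim (s (trans (σ≈τ _) t))
... | inj₂ (s , _) | inj₁ (t , _) = ⊥-elim (t (trans (sym (σ≈τ _)) s))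
... | inj₂ (_ , s) | inj₂ (_ , t) = inject₁-injective (trans s (trans (σ≈τ _) (sym t)))

ThreeCycle : ∀ {n} → (Fin n → Fin n) → Fin n → Fin n → Fin n → Set
ThreeCycle g a b c = g a ≡ b × g b ≡ c × g c ≡ a × a ≢ b × b ≢ c × c ≢ a

threeCycle : ∀ {n} (g : Fin n → Fin n) {a b c} → ThreeCycle g a b c →
  HasCycleOfLength g 3
threeCycle g {a} {b} {c} (ga , gb , gc , a≢b , b≢c , c≢a) = a , g³a≡a , returns
  where
  g²a≡c : iter g 2 a ≡ c
  g²a≡c = trans (cong g ga) gb
  g³a≡a : iter g 3 a ≡ a
  g³a≡a = trans (cong g g²a≡c) gc
  returns : ∀ j → 1 ≤ j → suc j ≤ 3 → iter g j a ≢ a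
  returns 1 _ _ eq = a≢b (trans (sym eq) ga)
  returns 2 _ _ eq = c≢a (trans (sym g²a≡c) eq)
  returns (suc (suc (suc j))) _ (s≤s (s≤s (s≤s ())))

fiveCycle : ∀ {n} (g : Fin n → Fin n) {a b c p q} →
  g a ≡ b → g b ≡ c → g c ≡ p → g p ≡ q → g q ≡ a →
  b ≢ a → c ≢ a → p ≢ a → q ≢ a → HasCycleOfLength g 5
fiveCycle g {a} {b} {c} {p} {q} ga gb gc gp gq b≢a c≢a p≢a q≢a =
  a , trans (cong g g⁴a≡q) gq , returns
  where
  g²a≡c : iter g 2 a ≡ c
  g²a≡c = trans (cong g ga) gb
  g³a≡p : iter g 3 a ≡ p
  g³a≡p = trans (cong g g²a≡c) gc
  g⁴a≡q : iter g 4 a ≡ q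
  g⁴a≡q = trans (cong g g³a≡p) gp
  returns : ∀ j → 1 ≤ j → suc j ≤ 5 → iter g j a ≢ a
  returns 1 _ _ eq = b≢a (trans (sym ga) eq)
  returns 2 _ _ eq = c≢a (trans (sym g²a≡c) eq)
  returns 3 _ _ eq = p≢a (trans (sym g³a≡p) eq)
  returns 4 _ _ eq = q≢a (trans (sym g⁴a≡q) eq)
  returns (suc (suc (suc (suc (suc j))))) _ (s≤s (s≤s (s≤s (s≤s (s≤s ())))))

-- Let f be injective on Fin (suc n) and f′ a map on Fin n such
-- that at every point y, f′ either agrees with f, or shortcuts a detour
-- y ↦ p ↦ q ↦ f′(y) of f through two given points p, q, or fixes y.  Since
-- a detour is entered only from f⁻¹(p), a 3-cycle of f′ uses at most one
-- detour, hence is a 3-cycle or (with the detour) a 5-cycle of f.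
module Splice {n} (f : Fin (suc n) → Fin (suc n)) (f′ : Fin n → Fin n)
  (f-injective : ∀ {x y} → f x ≡ f y → x ≡ y) (p q : Fin (suc n)) where

  Detour : Fin n → Fin n → Set
  Detour a b = f (inject₁ a) ≡ p × f p ≡ q × f q ≡ inject₁ b ×
               p ≢ inject₁ b × q ≢ inject₁ b

  Shape : Fin n → Set
  Shape y = f (inject₁ y) ≡ inject₁ (f′ y) ⊎ Detour y (f′ y) ⊎ f′ y ≡ y

  Edge : Fin n → Fin n → Set
  Edge a b = f (inject₁ a) ≡ inject₁ b ⊎ Detour a b

  edge : ∀ {a b} → Shape a → f′ a ≡ b → a ≢ b → Edge a b
  edge (inj₁ direct)          refl _   = inj₁ direct
  edge (inj₂ (inj₁ detour))   refl _   = inj₂ detour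
  edge (inj₂ (inj₂ fixed))    refl a≢b = ⊥-elim (a≢b (sym fixed))

  detour-unique : ∀ {a b a′ b′} → Detour a b → Detour a′ b′ → a ≡ a′
  detour-unique d d′ = inject₁-injective (f-injective (trans (proj₁ d) (sym (proj₁ d′))))

  inject₁-≢ : ∀ {a b : Fin n} → a ≢ b → inject₁ a ≢ inject₁ b
  inject₁-≢ a≢b eq = a≢b (inject₁-injective eq)

  withDetour : ∀ {a b c} → a ≢ b → c ≢ a → f (inject₁ a) ≡ inject₁ b →
    f (inject₁ b) ≡ inject₁ c → Detour c a → HasCycleOfLength f 5
  withDetour a≢b c≢a fa fb (fc , fp , fq , p≢a , q≢a) =
    fiveCycle f fa fb fc fp fq (λ eq → a≢b (inject₁-injective (sym eq)))
      (inject₁-≢ c≢a) p≢a q≢a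

  lift : ∀ {a b c} → ThreeCycle f′ a b c → (∀ y → Shape y) →
    HasCycleOfLength f 3 ⊎ HasCycleOfLength f 5
  lift {a} {b} {c} (f′a , f′b , f′c , a≢b , b≢c , c≢a) shape
    with edge (shape a) f′a a≢b | edge (shape b) f′b b≢c | edge (shape c) f′c c≢a
  ... | inj₁ fa | inj₁ fb | inj₁ fc =
    inj₁ (threeCycle f (fa , fb , fc , inject₁-≢ a≢b , inject₁-≢ b≢c , inject₁-≢ c≢a))
  ... | inj₁ fa | inj₁ fb | inj₂ dc = inj₂ (withDetour a≢b c≢a fa fb dc)
  ... | inj₁ fa | inj₂ db | inj₁ fc = inj₂ (withDetour c≢a b≢c fc fa db)
  ... | inj₂ da | inj₁ fb | inj₁ fc = inj₂ (withDetour b≢c a≢b fb fc da)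
  ... | _       | inj₂ db | inj₂ dc = ⊥-elim (b≢c (detour-unique db dc))
  ... | inj₂ da | _       | inj₂ dc = ⊥-elim (c≢a (sym (detour-unique da dc)))
  ... | inj₂ da | inj₂ db | _       = ⊥-elim (a≢b (detour-unique da db))

module Step {k} (σ τ : Permutation′ (suc k)) where

  last : Fin (suc k)
  last = fromℕ k

  σ′ τ′ : Permutation′ k
  σ′ = contract σ
  τ′ = contract τ

  f : Fin (suc k) → Fin (suc k)
  f = invComp σ τ
  f′ : Fin k → Fin k
  f′ = invComp σ′ τ′

  c e : Fin (suc k)
  c = σ ⟨$⟩ʳ last
  e = τ ⟨$⟩ʳ last

  f-c : f c ≡ e
  f-c = cong (τ ⟨$⟩ʳ_) (inverseˡ σ)

  f-injective : ∀ {x y} → f x ≡ f y → x ≡ y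
  f-injective {x} {y} fx≡fy =
    trans (sym (inverseʳ σ)) (trans (cong (σ ⟨$⟩ʳ_) σ⁻¹x≡σ⁻¹y) (inverseʳ σ))
    where
    σ⁻¹x≡σ⁻¹y : σ ⟨$⟩ˡ x ≡ σ ⟨$⟩ˡ y
    σ⁻¹x≡σ⁻¹y = trans (sym (inverseˡ τ)) (trans (cong (τ ⟨$⟩ˡ_) fx≡fy) (inverseˡ τ))

  σ-pre : ∀ {x y} → σ ⟨$⟩ʳ x ≡ y → x ≡ σ ⟨$⟩ˡ y
  σ-pre eq = trans (sym (inverseˡ σ)) (cong (σ ⟨$⟩ˡ_) eq)

  τ-pre : ∀ {x y} → τ ⟨$⟩ʳ x ≡ y → x ≡ τ ⟨$⟩ˡ y
  τ-pre eq = trans (sym (inverseˡ τ)) (cong (τ ⟨$⟩ˡ_) eq)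

  σ⁻¹-last : ∀ {y} → σ ⟨$⟩ˡ y ≡ last → y ≡ c
  σ⁻¹-last eq = trans (sym (inverseʳ σ)) (cong (σ ⟨$⟩ʳ_) eq)

  -- The three disagreements that contraction can lose: at the last point
  -- itself, at σ⁻¹(last) and at τ⁻¹(last).
  LostAtLast LostAtσ⁻¹ LostAtτ⁻¹ : Set
  LostAtLast = c ≢ e
  LostAtσ⁻¹  = f last ≡ c × c ≢ last
  LostAtτ⁻¹  = f e ≡ last × e ≢ last

  lostAtLast? : Dec LostAtLast
  lostAtLast? = ¬? (c ≟ e)
  lostAtσ⁻¹? : Dec LostAtσ⁻¹
  lostAtσ⁻¹? = (f last ≟ c) ×-dec ¬? (c ≟ last)
  lostAtτ⁻¹? : Dec LostAtτ⁻¹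
  lostAtτ⁻¹? = (f e ≟ last) ×-dec ¬? (e ≟ last)

  loss : ℕ
  loss = 𝟙 lostAtLast? + (𝟙 lostAtσ⁻¹? + 𝟙 lostAtτ⁻¹?)

  Lost : Fin k → Set
  Lost x = σ ⟨$⟩ʳ inject₁ x ≢ τ ⟨$⟩ʳ inject₁ x × σ′ ⟨$⟩ʳ x ≡ τ′ ⟨$⟩ʳ x

  lost? : ∀ x → Dec (Lost x)
  lost? x = disagree? σ τ (inject₁ x) ×-dec (σ′ ⟨$⟩ʳ x ≟ τ′ ⟨$⟩ʳ x)

  lost-σ? : ∀ x → Dec (Lost x × inject₁ x ≡ σ ⟨$⟩ˡ last)
  lost-σ? x = lost? x ×-dec (inject₁ x ≟ σ ⟨$⟩ˡ last)
  lost-τ? : ∀ x → Dec (Lost x × inject₁ x ≡ τ ⟨$⟩ˡ last)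
  lost-τ? x = lost? x ×-dec (inject₁ x ≟ τ ⟨$⟩ˡ last)

  -- A lost point is σ⁻¹(last) or τ⁻¹(last): elsewhere contraction keeps
  -- both values.
  lost-split : ∀ x → Lost x →
    (Lost x × inject₁ x ≡ σ ⟨$⟩ˡ last) ⊎ (Lost x × inject₁ x ≡ τ ⟨$⟩ˡ last)
  lost-split x lx@(σ≢τ , σ′≡τ′) with contract-spec σ x | contract-spec τ x
  ... | inj₂ (σx , _) | _             = inj₁ (lx , σ-pre σx)
  ... | inj₁ _        | inj₂ (τx , _) = inj₂ (lx , τ-pre τx)
  ... | inj₁ (_ , s)  | inj₁ (_ , t)  =
    ⊥-elim (σ≢τ (trans (sym s) (trans (cong inject₁ σ′≡τ′) t)))

  lost-σ⇒ : ∀ x → Lost x × inject₁ x ≡ σ ⟨$⟩ˡ last → LostAtσ⁻¹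
  lost-σ⇒ x ((σ≢τ , σ′≡τ′) , x≡) with contract-spec σ x | contract-spec τ x
  ... | inj₁ (σx≢ , _) | _              = ⊥-elim (σx≢ (trans (cong (σ ⟨$⟩ʳ_) x≡) (inverseʳ σ)))
  ... | inj₂ (σx , _)  | inj₂ (τx , _)  = ⊥-elim (σ≢τ (trans σx (sym τx)))
  ... | inj₂ (_ , s)   | inj₁ (τx≢ , t) = f-last , λ c≡last → τx≢ (trans τx≡c c≡last)
    where
    τx≡c : τ ⟨$⟩ʳ inject₁ x ≡ c
    τx≡c = trans (sym t) (trans (cong inject₁ (sym σ′≡τ′)) s)
    f-last : f last ≡ c
    f-last = trans (cong (τ ⟨$⟩ʳ_) (sym x≡)) τx≡c

  lost-τ⇒ : ∀ x → Lost x × inject₁ x ≡ τ ⟨$⟩ˡ last → LostAtτ⁻¹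
  lost-τ⇒ x ((σ≢τ , σ′≡τ′) , x≡) with contract-spec σ x | contract-spec τ x
  ... | _              | inj₁ (τx≢ , _) = ⊥-elim (τx≢ (trans (cong (τ ⟨$⟩ʳ_) x≡) (inverseʳ τ)))
  ... | inj₂ (σx , _)  | inj₂ (τx , _)  = ⊥-elim (σ≢τ (trans σx (sym τx)))
  ... | inj₁ (σx≢ , s) | inj₂ (τx , t)  = f-e , λ e≡last → σx≢ (trans σx≡e e≡last)
    where
    σx≡e : σ ⟨$⟩ʳ inject₁ x ≡ e
    σx≡e = trans (sym s) (trans (cong inject₁ σ′≡τ′) t)
    f-e : f e ≡ last
    f-e = trans (cong (τ ⟨$⟩ʳ_) (trans (cong (σ ⟨$⟩ˡ_) (sym σx≡e)) (inverseˡ σ))) τx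

  at-most-one : ∀ (y : Fin (suc k)) x x′ →
    Lost x × inject₁ x ≡ y → Lost x′ × inject₁ x′ ≡ y → x ≡ x′
  at-most-one y x x′ (_ , x≡y) (_ , x′≡y) = inject₁-injective (trans x≡y (sym x′≡y))

  disagree-split : ∀ x → σ ⟨$⟩ʳ inject₁ x ≢ τ ⟨$⟩ʳ inject₁ x →
    σ′ ⟨$⟩ʳ x ≢ τ′ ⟨$⟩ʳ x ⊎ Lost x
  disagree-split x σ≢τ with σ′ ⟨$⟩ʳ x ≟ τ′ ⟨$⟩ʳ x
  ... | yes σ′≡τ′ = inj₂ (σ≢τ , σ′≡τ′)
  ... | no σ′≢τ′  = inj₁ σ′≢τ′

  hd-step : hd σ τ ≤ hd σ′ τ′ + loss
  hd-step = begin
      hd σ τ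
    ≡⟨ hd-count σ τ ⟩
      count (disagree? σ τ)
    ≡⟨ count-last (disagree? σ τ) ⟩
      count (λ x → disagree? σ τ (inject₁ x)) + 𝟙 lostAtLast?
    ≤⟨ +-monoˡ-≤ (𝟙 lostAtLast?) (count-∪ _ (disagree? σ′ τ′) lost? disagree-split) ⟩
      (count (disagree? σ′ τ′) + count lost?) + 𝟙 lostAtLast?
    ≤⟨ +-monoˡ-≤ (𝟙 lostAtLast?) (+-monoʳ-≤ (count (disagree? σ′ τ′)) lost≤) ⟩
      (count (disagree? σ′ τ′) + (𝟙 lostAtσ⁻¹? + 𝟙 lostAtτ⁻¹?)) + 𝟙 lostAtLast?
    ≡⟨ +-assoc (count (disagree? σ′ τ′)) _ _ ⟩
      count (disagree? σ′ τ′) + ((𝟙 lostAtσ⁻¹? + 𝟙 lostAtτ⁻¹?) + 𝟙 lostAtLast?)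
    ≡⟨ cong₂ _+_ (sym (hd-count σ′ τ′)) (+-comm (𝟙 lostAtσ⁻¹? + 𝟙 lostAtτ⁻¹?) _) ⟩
      hd σ′ τ′ + loss
    ∎
    where
    open ≤-Reasoning
    lost≤ : count lost? ≤ 𝟙 lostAtσ⁻¹? + 𝟙 lostAtτ⁻¹?
    lost≤ = ≤-trans (count-∪ lost? lost-σ? lost-τ? lost-split)
      (+-mono-≤ (count≤𝟙 lost-σ? lostAtσ⁻¹? lost-σ⇒ (at-most-one _))
                (count≤𝟙 lost-τ? lostAtτ⁻¹? lost-τ⇒ (at-most-one _)))

  allLost⇒threeCycle : LostAtLast → LostAtσ⁻¹ → LostAtτ⁻¹ → ThreeCycle f last c e
  allLost⇒threeCycle c≢e (f-last , c≢last) (f-e , e≢last) =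
    f-last , f-c , f-e , (λ eq → c≢last (sym eq)) , c≢e , e≢last

  lostσ⁻¹τ⁻¹⇒lostAtLast : LostAtσ⁻¹ → LostAtτ⁻¹ → LostAtLast
  lostσ⁻¹τ⁻¹⇒lostAtLast (f-last , c≢last) _ c≡e =
    c≢last (sym (f-injective (trans f-last (trans c≡e (sym f-c)))))

  shape-σ⁻¹ : LostAtLast → LostAtσ⁻¹ → ∀ y → Splice.Shape f f′ f-injective last c y
  shape-σ⁻¹ c≢e (f-last , c≢last) y with contract-specˡ σ y | contract-spec τ (σ′ ⟨$⟩ˡ y)
  ... | inj₁ (_ , s) | inj₁ (_ , t) = inj₁ (sym (trans t (cong (τ ⟨$⟩ʳ_) s)))
  ... | inj₁ (_ , s) | inj₂ (τz , t) = inj₂ (inj₁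
        (trans (cong (τ ⟨$⟩ʳ_) (sym s)) τz , f-last , trans f-c (sym t) ,
         fromℕ≢inject₁ , λ c≡ → c≢e (trans c≡ t)))
  ... | inj₂ (σy , s) | inj₁ (_ , t) = inj₂ (inj₂ (inject₁-injective
        (trans t (trans (cong (τ ⟨$⟩ʳ_) s) (trans f-last (sym (σ⁻¹-last σy)))))))
  ... | inj₂ (σy , s) | inj₂ (τz , _) =
        ⊥-elim (c≢last (trans (sym f-last) (trans (cong (τ ⟨$⟩ʳ_) (sym s)) τz)))

  shape-τ⁻¹ : LostAtLast → LostAtτ⁻¹ → ∀ y → Splice.Shape f f′ f-injective e last y
  shape-τ⁻¹ c≢e (f-e , e≢last) y with contract-specˡ σ y | contract-spec τ (σ′ ⟨$⟩ˡ y)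
  ... | inj₁ (_ , s) | inj₁ (_ , t) = inj₁ (sym (trans t (cong (τ ⟨$⟩ʳ_) s)))
  ... | inj₁ (_ , s) | inj₂ (τz , t) = inj₂ (inj₂ (inject₁-injective
        (trans t (sym (f-injective (trans (trans (cong (τ ⟨$⟩ʳ_) (sym s)) τz) (sym f-e)))))))
  ... | inj₂ (σy , s) | inj₁ (_ , t) = inj₂ (inj₁
        (trans (cong f (σ⁻¹-last σy)) f-c , f-e , f-last ,
         (λ e≡ → fromℕ≢inject₁ (sym (trans (σ⁻¹-last σy)
                   (f-injective (trans f-c (trans e≡ (sym f-last))))))) ,
         fromℕ≢inject₁))
    where
    f-last : f last ≡ inject₁ (f′ y)
    f-last = sym (trans t (cong (τ ⟨$⟩ʳ_) s))
  ... | inj₂ (σy , s) | inj₂ (τz , _) =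
        ⊥-elim (e≢last (sym (f-injective (trans (trans (cong (τ ⟨$⟩ʳ_) (sym s)) τz) (sym f-e)))))

  loss≤3 : loss ≤ 3
  loss≤3 = +-mono-≤ (𝟙≤1 lostAtLast?) (+-mono-≤ (𝟙≤1 lostAtσ⁻¹?) (𝟙≤1 lostAtτ⁻¹?))

  allLost? : Dec (LostAtLast × LostAtσ⁻¹ × LostAtτ⁻¹)
  allLost? = lostAtLast? ×-dec lostAtσ⁻¹? ×-dec lostAtτ⁻¹?

  loss≤2 : ¬ (LostAtLast × LostAtσ⁻¹ × LostAtτ⁻¹) → loss ≤ 2
  loss≤2 = 𝟙-sum≤2 lostAtLast? lostAtσ⁻¹? lostAtτ⁻¹?

  noThreeCycle⇒loss≤2 : ¬ HasCycleOfLength f 3 → loss ≤ 2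
  noThreeCycle⇒loss≤2 no3 = loss≤2 λ (l , lσ , lτ) → no3 (threeCycle f (allLost⇒threeCycle l lσ lτ))

  loss≤1 : ¬ HasCycleOfLength f 3 → ¬ HasCycleOfLength f 5 →
    ∀ {a b c} → ThreeCycle f′ a b c → loss ≤ 1
  loss≤1 no3 no5 cyc = 𝟙-sum≤1 lostAtLast? lostAtσ⁻¹? lostAtτ⁻¹?
    (λ (l , lσ) → [ no3 , no5 ] (Splice.lift f f′ f-injective last c cyc (shape-σ⁻¹ l lσ)))
    (λ (l , lτ) → [ no3 , no5 ] (Splice.lift f f′ f-injective e last cyc (shape-τ⁻¹ l lτ)))
    (λ (lσ , lτ) → no3 (threeCycle f (allLost⇒threeCycle (lostσ⁻¹τ⁻¹⇒lostAtLast lσ lτ) lσ lτ)))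

chain : ∀ {a b c i j r} → a ≤ b + i → b ≤ c + j → j + i ≤ r → a ≤ c + r
chain {c = c} {i} {j} a≤b+i b≤c+j j+i≤r =
  ≤-trans a≤b+i (≤-trans (+-monoˡ-≤ i b≤c+j)
    (≤-trans (≤-reflexive (+-assoc c j i)) (+-monoʳ-≤ c j+i≤r)))

hd-contract²≤+6 : ∀ {m} (σ τ : Permutation′ (2 + m)) →
  hd σ τ ≤ hd (contract² σ) (contract² τ) + 6
hd-contract²≤+6 σ τ = chain (Step.hd-step σ τ) (Step.hd-step (contract σ) (contract τ))
  (+-mono-≤ (Step.loss≤3 (contract σ) (contract τ)) (Step.loss≤3 σ τ))

-- Without 3- and 5-cycles in σ⁻¹τ: either the second step loses at most two
-- points (and so does the first), or σ′⁻¹τ′ has a 3-cycle, and then the first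
-- step loses at most one point.
hd-contract²≤+4 : ∀ {m} (σ τ : Permutation′ (2 + m)) →
  ¬ HasCycleOfLength (invComp σ τ) 3 → ¬ HasCycleOfLength (invComp σ τ) 5 →
  hd σ τ ≤ hd (contract² σ) (contract² τ) + 4
hd-contract²≤+4 σ τ no3 no5 with Step.allLost? (contract σ) (contract τ)
... | no notAll = chain (Step.hd-step σ τ) (Step.hd-step (contract σ) (contract τ))
  (+-mono-≤ (Step.loss≤2 (contract σ) (contract τ) notAll) (Step.noThreeCycle⇒loss≤2 σ τ no3))
... | yes (l , lσ , lτ) = chain (Step.hd-step σ τ) (Step.hd-step (contract σ) (contract τ))
  (+-mono-≤ (Step.loss≤3 (contract σ) (contract τ))
            (Step.loss≤1 σ τ no3 no5 (Step.allLost⇒threeCycle (contract σ) (contract τ) l lσ lτ)))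

contract²Array-hd : ∀ {m} (P : PermArray (2 + m)) (d r : ℕ) → HDAtLeast P d →
  (∀ σ τ → P σ → P τ → ¬ (σ ≈ₚ τ) → hd σ τ ≤ hd (contract² σ) (contract² τ) + r) →
  HDAtLeast (contract²Array P) (d ∸ r)
contract²Array-hd P d r hdP drop ρ ρ′ (σ , Pσ , ρ≈σ) (τ , Pτ , ρ′≈τ) ρ≉ρ′ =
  m≤n+o⇒m∸n≤o d r (≤-trans (hdP σ τ Pσ Pτ σ≉τ)
    (≤-trans (drop σ τ Pσ Pτ σ≉τ)
      (≤-trans (+-monoˡ-≤ r (hd-resp-≈ {π = contract² σ} {ρ} {contract² τ} {ρ′}
                               (λ x → sym (ρ≈σ x)) (λ x → sym (ρ′≈τ x))))
        (≤-reflexive (+-comm (hd ρ ρ′) r)))))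
  where
  σ≉τ : ¬ (σ ≈ₚ τ)
  σ≉τ σ≈τ = ρ≉ρ′ λ x → trans (ρ≈σ x)
    (trans (contract-resp-≈ {σ = contract σ} {contract τ}
             (contract-resp-≈ {σ = σ} {τ} σ≈τ) x) (sym (ρ′≈τ x)))

theorem3 : (m d : ℕ) (P : PermArray (2 + m)) →
    HasHammingDistance P d →
    HDAtLeast (contract²Array P) (d ∸ 6) ×
    ((∀ σ τ → P σ → P τ → ¬ (σ ≈ₚ τ) →
        ¬ HasCycleOfLength (invComp σ τ) 3 × ¬ HasCycleOfLength (invComp σ τ) 5) →
      HDAtLeast (contract²Array P) (d ∸ 4))
theorem3 m d P (hdP , _) =
  contract²Array-hd P d 6 hdP (λ σ τ _ _ _ → hd-contract²≤+6 σ τ) ,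
  λ noShortCycles → contract²Array-hd P d 4 hdP λ σ τ Pσ Pτ σ≉τ →
    let (no3 , no5) = noShortCycles σ τ Pσ Pτ σ≉τ
    in hd-contract²≤+4 σ τ no3 no5
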